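{- Consider a well-structured PCMG$_\le$ $N$ obtained from an acyclic, connected, undirected graph $G$. Then each place belongs to a minimal siphon and a minimal trap of $N$, and each minimal siphon, each minimal trap, induces a (strongly) connected state machine P-subnet of $N$.
   Context: Given a connected undirected graph $G=(V,E)$ whose edges connect distinct vertices, a PCMG$_\le$ (place-composed marked graph with relaxed place constraints) obtained from $G$ is built as follows: take a unit-weighted Petri net in which each place has at most one input and at most one output transition, having exactly $|E|$ maximal connected components, each with at least two places; associate bijectively a component $\beta(e)$ to each edge $e$, and to each edge $e=\{v_a,v_b\}$ a pair of distinct places of $\beta(e)$, one for $v_a$ and one for $v_b$; then, for each vertex $v$, merge all places associated to $v$ into a single place (arc weights being summed). The PCMG$_\le$ is well-structured if each component is a strongly connected marked graph (each place exactly one input and one output, unit weights) that is well-formed (structurally live and structurally bounded). A siphon is a nonempty place set $D$ with ${}^\bullet D\subseteq D^\bullet$; a trap is a nonempty place set $Q$ with $Q^\bullet\subseteq{}^\bullet Q$; minimal means containing no proper siphon (resp. trap). A state machine is an ordinary net in which each transition has exactly one input and one output place. The P-subnet induced by places $P'$ has transitions ${}^\bullet P'\cup P'^\bullet$. -}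

module Defs where

open import Level using (0ℓ)
open import Data.Nat using (ℕ; zero; suc; _≤_; _<_; _∸_; _+_)
open import Data.Fin using (Fin) renaming (_≟_ to _≟ᶠ_)
open import Data.Product using (Σ; Σ-syntax; ∃; ∃-syntax; _×_; _,_)
open import Data.Sum using (_⊎_; inj₁; inj₂)
open import Data.Empty using (⊥)
open import Relation.Nullary using (¬_; yes; no)
open import Relation.Unary using (Pred; _⊆_)
open import Relation.Binary using (Rel)
open import Relation.Binary.PropositionalEquality using (_≡_; _≢_; refl)
open import Relation.Binary.Construct.Closure.ReflexiveTransitive using (Star)
open import Relation.Binary.Construct.Closure.Symmetric using (SymClosure)

-- Undirected graphs (edges connect distinct vertices; parallel edges are
-- not excluded a priori, acyclicity excludes them anyway).

record Graph : Set where
  field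
    n m      : ℕ
    src tgt  : Fin m → Fin n
    loopless : ∀ e → src e ≢ tgt e

module _ (G : Graph) where
  open Graph G

  Joins : Fin m → Fin n → Fin n → Set
  Joins e u v = (src e ≡ u × tgt e ≡ v) ⊎ (src e ≡ v × tgt e ≡ u)

  Adj : Rel (Fin n) 0ℓ
  Adj u v = ∃[ e ] Joins e u v

  GConnected : Set
  GConnected = ∀ u v → Star Adj u v

  record Cycle : Set where
    field
      k       : ℕ
      k≥2     : 2 ≤ k
      vs      : ℕ → Fin n
      es      : ℕ → Fin m
      step    : ∀ i → i < k → Joins (es i) (vs i) (vs (suc i))
      closed  : vs k ≡ vs 0
      vs-inj  : ∀ i j → i < k → j < k → vs i ≡ vs j → i ≡ j
      es-inj  : ∀ i j → i < k → j < k → es i ≡ es j → i ≡ j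

  Acyclic : Set
  Acyclic = ¬ Cycle

-- Petri nets (weighted; pre p t = weight of arc p → t, post p t = weight
-- of arc t → p).

record Net : Set₁ where
  constructor mkNet
  field
    Pl Tr : Set
    pre post : Pl → Tr → ℕ

module _ (N : Net) where
  open Net N

  Node : Set
  Node = Pl ⊎ Tr

  Arc : Rel Node 0ℓ
  Arc (inj₁ p) (inj₂ t) = 1 ≤ pre p t
  Arc (inj₂ t) (inj₁ p) = 1 ≤ post p t
  Arc (inj₁ _) (inj₁ _) = ⊥
  Arc (inj₂ _) (inj₂ _) = ⊥

  WeaklyConnected : Set
  WeaklyConnected = ∀ x y → Star (SymClosure Arc) x y

  StronglyConnected : Set
  StronglyConnected = ∀ x y → Star Arc x y

  UnitWeighted : Set
  UnitWeighted = ∀ p t → pre p t ≤ 1 × post p t ≤ 1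

  MarkedGraph : Set
  MarkedGraph = UnitWeighted
    × (∀ p → ∃[ t ] (1 ≤ post p t × ∀ t' → 1 ≤ post p t' → t' ≡ t))
    × (∀ p → ∃[ t ] (1 ≤ pre p t × ∀ t' → 1 ≤ pre p t' → t' ≡ t))

  Marking : Set
  Marking = Pl → ℕ

  Enabled : Marking → Tr → Set
  Enabled M t = ∀ p → pre p t ≤ M p

  Fire : Rel Marking 0ℓ
  Fire M M' = ∃[ t ] (Enabled M t × ∀ p → M' p ≡ M p ∸ pre p t + post p t)

  Reach : Rel Marking 0ℓ
  Reach = Star Fire

  Live : Marking → Set
  Live M₀ = ∀ M → Reach M₀ M → ∀ t → ∃[ M' ] (Reach M M' × Enabled M' t)

  Bounded : Marking → Set
  Bounded M₀ = ∃[ b ] (∀ M → Reach M₀ M → ∀ p → M p ≤ b)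

  StructurallyLive : Set
  StructurallyLive = ∃[ M₀ ] Live M₀

  StructurallyBounded : Set
  StructurallyBounded = ∀ M₀ → Bounded M₀

  WellFormed : Set
  WellFormed = StructurallyLive × StructurallyBounded

  Siphon : Pred Pl 0ℓ → Set
  Siphon D = (∃[ p ] D p)
    × (∀ t → (∃[ p ] (D p × 1 ≤ post p t)) → ∃[ q ] (D q × 1 ≤ pre q t))

  Trap : Pred Pl 0ℓ → Set
  Trap Q = (∃[ p ] Q p)
    × (∀ t → (∃[ p ] (Q p × 1 ≤ pre p t)) → ∃[ q ] (Q q × 1 ≤ post q t))

  MinimalSiphon : Pred Pl 0ℓ → Set₁
  MinimalSiphon D = Siphon D × (∀ D' → D' ⊆ D → Siphon D' → D ⊆ D')

  MinimalTrap : Pred Pl 0ℓ → Set₁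
  MinimalTrap Q = Trap Q × (∀ Q' → Q' ⊆ Q → Trap Q' → Q ⊆ Q')

  PSubTr : Pred Pl 0ℓ → Pred Tr 0ℓ
  PSubTr P' t = (∃[ p ] (P' p × 1 ≤ post p t)) ⊎ (∃[ p ] (P' p × 1 ≤ pre p t))

  PSubNode : Pred Pl 0ℓ → Pred Node 0ℓ
  PSubNode P' (inj₁ p) = P' p
  PSubNode P' (inj₂ t) = PSubTr P' t

  PSubArc : Pred Pl 0ℓ → Rel Node 0ℓ
  PSubArc P' x y = PSubNode P' x × PSubNode P' y × Arc x y

  PSubStateMachine : Pred Pl 0ℓ → Set
  PSubStateMachine P' = ∀ t → PSubTr P' t →
      (∀ p → P' p → pre p t ≤ 1 × post p t ≤ 1)
    × (∃[ p ] (P' p × 1 ≤ pre p t × ∀ q → P' q → 1 ≤ pre q t → q ≡ p))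
    × (∃[ p ] (P' p × 1 ≤ post p t × ∀ q → P' q → 1 ≤ post q t → q ≡ p))

  PSubStronglyConnected : Pred Pl 0ℓ → Set
  PSubStronglyConnected P' =
    ∀ x y → PSubNode P' x → PSubNode P' y → Star (PSubArc P') x y

  PSubConnectedStateMachine : Pred Pl 0ℓ → Set
  PSubConnectedStateMachine P' = PSubStateMachine P' × PSubStronglyConnected P'

-- The initial net is given as the disjoint
-- union of its |E| maximal connected components, the component β(e) being
-- indexed by the edge e (this encodes the bijection β).  Component e has
-- places Fin (np e), transitions Fin (nt e); pa e / pb e are the places
-- associated with the endpoints src e / tgt e of e.

record PCMG≤ (G : Graph) : Set where
  open Graph G
  field
    np nt   : Fin m → ℕ
    cpre    : (e : Fin m) → Fin (np e) → Fin (nt e) → ℕ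
    cpost   : (e : Fin m) → Fin (np e) → Fin (nt e) → ℕ
    unit    : ∀ e p t → cpre e p t ≤ 1 × cpost e p t ≤ 1
    ≤1-in   : ∀ e p t t' → 1 ≤ cpost e p t → 1 ≤ cpost e p t' → t ≡ t'
    ≤1-out  : ∀ e p t t' → 1 ≤ cpre e p t → 1 ≤ cpre e p t' → t ≡ t'
    comp-connected : ∀ e → WeaklyConnected
                       (mkNet (Fin (np e)) (Fin (nt e)) (cpre e) (cpost e))
    two-places : ∀ e → 2 ≤ np e
    pa pb   : (e : Fin m) → Fin (np e)
    pa≢pb   : ∀ e → pa e ≢ pb e

module _ {G : Graph} (C : PCMG≤ G) where
  open Graph G
  open PCMG≤ C

  comp : Fin m → Net
  comp e = mkNet (Fin (np e)) (Fin (nt e)) (cpre e) (cpost e)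

  -- places of the merged net: one place per vertex (the merge of all
  -- places associated with it), plus the non-associated component places
  MPlace : Set
  MPlace = Fin n ⊎ Σ[ e ∈ Fin m ] Σ[ p ∈ Fin (np e) ] (p ≢ pa e × p ≢ pb e)

  MTrans : Set
  MTrans = Σ[ e ∈ Fin m ] Fin (nt e)

  -- arc weights of the merged place v w.r.t. transitions of component e:
  -- sum over the places of e associated with v (at most one such place,
  -- since src e ≢ tgt e)
  mweight : (Fin m → Fin n) → (e : Fin m) → Fin n → ℕ → ℕ
  mweight end e v w with v ≟ᶠ end e
  ... | yes _ = w
  ... | no  _ = 0

  mpre : MPlace → MTrans → ℕ
  mpre (inj₁ v) (e , t) = mweight src e v (cpre e (pa e) t) + mweight tgt e v (cpre e (pb e) t)
  mpre (inj₂ (e , p , _)) (e' , t) with e ≟ᶠ e'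
  ... | yes refl = cpre e p t
  ... | no  _    = 0

  mpost : MPlace → MTrans → ℕ
  mpost (inj₁ v) (e , t) = mweight src e v (cpost e (pa e) t) + mweight tgt e v (cpost e (pb e) t)
  mpost (inj₂ (e , p , _)) (e' , t) with e ≟ᶠ e'
  ... | yes refl = cpost e p t
  ... | no  _    = 0

  net : Net
  net = mkNet MPlace MTrans mpre mpost

  WellStructured : Set
  WellStructured = ∀ e → MarkedGraph (comp e) × StronglyConnected (comp e)
                             × WellFormed (comp e)

module Submission where

-- Since G is a forest, a path of the merged net that leaves a component
-- through a vertex place can only come back to that component through the
-- same place.  With minimality this forces a minimal siphon to contain
-- exactly one input and one output place of each of its transitions and to
-- be strongly connected.  A minimal siphon through a given place is built from
-- an elementary circuit through it in its component, adding, whenever a chosen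
-- circuit meets a vertex place, a circuit through that place in every other
-- component at that vertex; acyclicity again ensures that no component
-- receives two circuits.  Traps are the siphons of the reversed net, whose
-- components are again strongly connected marked graphs.

open import Defs
open import Level using (0ℓ)
open import Data.Nat using (ℕ; zero; suc; _≤_; _<_; z≤n; s≤s; _≤?_; _<?_; _+_; _*_)
open import Data.Nat.Properties
  using (≤-refl; <⇒≤; ≤∧≢⇒<; ≤-pred; <-irrefl; +-comm; +-identityʳ; *-suc)
open import Data.Fin using (Fin) renaming (_≟_ to _≟ᶠ_)
open import Data.Product using (Σ; ∃-syntax; _×_; _,_; proj₁; proj₂)
  renaming (swap to ×-swap)
import Data.Product.Properties as Product
open import Data.Sum using (_⊎_; inj₁; inj₂) renaming (swap to ⊎-swap)
import Data.Sum.Properties as Sum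
open import Data.Empty using (⊥; ⊥-elim)
open import Data.List using (List; []; _∷_; _++_)
open import Data.List.Properties using (++-assoc)
open import Data.List.Membership.Propositional.Properties using (∈-++⁻; ∈-++⁺ʳ)
open import Data.List.Relation.Unary.Any using (here; there)
open import Data.List.Membership.Propositional using (_∈_)
open import Relation.Nullary using (¬_; yes; no; Dec)
open import Relation.Nullary.Decidable using (_⊎-dec_)
open import Data.Fin.Properties using (any?)
open import Relation.Unary using (Pred; _⊆_)
open import Relation.Binary using (Rel; DecidableEquality)
open import Relation.Binary.PropositionalEquality
  using (_≡_; _≢_; refl; sym; trans; cong; subst; ≢-sym; module ≡-Reasoning)
open import Relation.Binary.Construct.Closure.ReflexiveTransitive
  using (Star; ε; _◅_; _◅◅_; reverse)

module GraphFacts (G : Graph) where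
  open Graph G

  Endpoint : Fin m → Fin n → Set
  Endpoint e v = src e ≡ v ⊎ tgt e ≡ v

  AdjWithout : Fin m → Rel (Fin n) 0ℓ
  AdjWithout e u w = ∃[ e' ] (e' ≢ e × Joins G e' u w)

  joins-sym : ∀ {e u w} → Joins G e u w → Joins G e w u
  joins-sym (inj₁ (a , b)) = inj₂ (a , b)
  joins-sym (inj₂ (a , b)) = inj₁ (a , b)

  joins⇒endpointˡ : ∀ {e u w} → Joins G e u w → Endpoint e u
  joins⇒endpointˡ (inj₁ (a , _)) = inj₁ a
  joins⇒endpointˡ (inj₂ (_ , b)) = inj₂ b

  endpoints⇒joins : ∀ {e u w} → Endpoint e u → Endpoint e w → u ≢ w → Joins G e u w
  endpoints⇒joins (inj₁ a) (inj₁ b) u≢w = ⊥-elim (u≢w (trans (sym a) b))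
  endpoints⇒joins (inj₁ a) (inj₂ b) _   = inj₁ (a , b)
  endpoints⇒joins (inj₂ a) (inj₁ b) _   = inj₂ (b , a)
  endpoints⇒joins (inj₂ a) (inj₂ b) u≢w = ⊥-elim (u≢w (trans (sym a) b))

  joins⇒≢ : ∀ {e u w} → Joins G e u w → u ≢ w
  joins⇒≢ {e} (inj₁ (a , b)) refl = loopless e (trans a (sym b))
  joins⇒≢ {e} (inj₂ (a , b)) refl = loopless e (trans a (sym b))

  joins-endpoints : ∀ {e a b c d} → Joins G e a b → Joins G e c d →
                    (a ≡ c × b ≡ d) ⊎ (a ≡ d × b ≡ c)
  joins-endpoints (inj₁ (p , q)) (inj₁ (r , s)) = inj₁ (trans (sym p) r , trans (sym q) s)
  joins-endpoints (inj₁ (p , q)) (inj₂ (r , s)) = inj₂ (trans (sym p) r , trans (sym q) s)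
  joins-endpoints (inj₂ (p , q)) (inj₁ (r , s)) = inj₂ (trans (sym q) s , trans (sym p) r)
  joins-endpoints (inj₂ (p , q)) (inj₂ (r , s)) = inj₁ (trans (sym q) s , trans (sym p) r)

  walk-reverse : ∀ {e a b} → Star (AdjWithout e) a b → Star (AdjWithout e) b a
  walk-reverse = reverse (λ { (e' , ne , j) → e' , ne , joins-sym j })

  endpoints-connected : ∀ {e e' u w} → e' ≢ e → Endpoint e' u → Endpoint e' w →
                        Star (AdjWithout e) u w
  endpoints-connected {u = u} {w} e'≢e eu ew with u ≟ᶠ w
  ... | yes refl = ε
  ... | no u≢w   = (_ , e'≢e , endpoints⇒joins eu ew u≢w) ◅ ε

  avoid-or-reach : ∀ {e e' w a b} → e' ≢ e → Endpoint e' w → Star (AdjWithout e) a b →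
                   Star (AdjWithout e') a b ⊎ Star (AdjWithout e) a w
  avoid-or-reach _ _ ε = inj₁ ε
  avoid-or-reach {e' = e'} {w} {a} e'≢e ew ((e'' , e''≢e , j) ◅ rest) with e'' ≟ᶠ e' | a ≟ᶠ w
  ... | yes refl | yes refl = inj₂ ε
  ... | yes refl | no a≢w   = inj₂ ((e' , e'≢e , endpoints⇒joins (joins⇒endpointˡ j) ew a≢w) ◅ ε)
  ... | no e''≢e' | _ with avoid-or-reach e'≢e ew rest
  ...   | inj₁ r = inj₁ ((e'' , e''≢e' , j) ◅ r)
  ...   | inj₂ r = inj₂ ((e'' , e''≢e , j) ◅ r)

  module SimpleWalks (e : Fin m) where
    open import Data.List.Membership.DecPropositional (_≟ᶠ_ {n}) using (_∈?_)

    -- SimpleWalk b a vs: a walk from a to b avoiding e, visiting exactly vs.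
    data SimpleWalk (b : Fin n) : Fin n → List (Fin n) → Set where
      stop : SimpleWalk b b (b ∷ [])
      step : ∀ {a c vs} → AdjWithout e a c → SimpleWalk b c vs → ¬ a ∈ vs →
             SimpleWalk b a (a ∷ vs)

    from-visited : ∀ {a b c vs} → SimpleWalk b c vs → a ∈ vs → ∃[ vs' ] SimpleWalk b a vs'
    from-visited stop         (here refl) = _ , stop
    from-visited stop         (there ())
    from-visited (step s w a∉) (here refl) = _ , step s w a∉
    from-visited (step _ w _) (there a∈) = from-visited w a∈

    walk⇒simpleWalk : ∀ {a b} → Star (AdjWithout e) a b → ∃[ vs ] SimpleWalk b a vs
    walk⇒simpleWalk ε = _ , stop
    walk⇒simpleWalk {a} (s ◅ rest) with walk⇒simpleWalk rest
    ... | vs , w with a ∈? vs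
    ...   | yes a∈ = from-visited w a∈
    ...   | no  a∉ = _ , step s w a∉

    length : ∀ {a b vs} → SimpleWalk b a vs → ℕ
    length stop         = 0
    length (step _ w _) = suc (length w)

    vertex : ∀ {a b vs} → SimpleWalk b a vs → ℕ → Fin n
    vertex {b = b} stop         _       = b
    vertex {a}     (step _ _ _) zero    = a
    vertex         (step _ w _) (suc i) = vertex w i

    edge : ∀ {a b vs} → SimpleWalk b a vs → ℕ → Fin m
    edge stop                _       = e
    edge (step (e' , _) _ _) zero    = e'
    edge (step _ w _)        (suc i) = edge w i

    vertex-length : ∀ {a b vs} (w : SimpleWalk b a vs) → vertex w (length w) ≡ b
    vertex-length stop         = refl
    vertex-length (step _ w _) = vertex-length w

    vertex-0 : ∀ {a b vs} (w : SimpleWalk b a vs) → vertex w 0 ≡ a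
    vertex-0 stop         = refl
    vertex-0 (step _ _ _) = refl

    edge-joins : ∀ {a b vs} (w : SimpleWalk b a vs) i → i < length w →
                 Joins G (edge w i) (vertex w i) (vertex w (suc i))
    edge-joins (step (_ , _ , j) w _) zero    _       = subst (Joins G _ _) (sym (vertex-0 w)) j
    edge-joins (step _ w _)           (suc i) (s≤s i<) = edge-joins w i i<

    edge-≢ : ∀ {a b vs} (w : SimpleWalk b a vs) i → i < length w → edge w i ≢ e
    edge-≢ (step (_ , e'≢e , _) _ _) zero    _        = e'≢e
    edge-≢ (step _ w _)              (suc i) (s≤s i<) = edge-≢ w i i<

    vertex-∈ : ∀ {a b vs} (w : SimpleWalk b a vs) i → i ≤ length w → vertex w i ∈ vs
    vertex-∈ stop         zero    _        = here refl
    vertex-∈ (step _ _ _) zero    _        = here refl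
    vertex-∈ (step _ w _) (suc i) (s≤s i≤) = there (vertex-∈ w i i≤)

    vertex-injective : ∀ {a b vs} (w : SimpleWalk b a vs) i j → i ≤ length w → j ≤ length w →
                       vertex w i ≡ vertex w j → i ≡ j
    vertex-injective stop         zero    zero    _        _        _  = refl
    vertex-injective (step _ _ _) zero    zero    _        _        _  = refl
    vertex-injective (step _ w a∉) zero    (suc j) _        (s≤s j≤) eq =
      ⊥-elim (a∉ (subst (_∈ _) (sym eq) (vertex-∈ w j j≤)))
    vertex-injective (step _ w a∉) (suc i) zero    (s≤s i≤) _        eq =
      ⊥-elim (a∉ (subst (_∈ _) eq (vertex-∈ w i i≤)))
    vertex-injective (step _ w _) (suc i) (suc j) (s≤s i≤) (s≤s j≤) eq =
      cong suc (vertex-injective w i j i≤ j≤ eq)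

    edge-injective : ∀ {a b vs} (w : SimpleWalk b a vs) i j → i < length w → j < length w →
                     edge w i ≡ edge w j → i ≡ j
    edge-injective w i j i< j< eq
      with joins-endpoints (edge-joins w i i<)
             (subst (λ x → Joins G x _ _) (sym eq) (edge-joins w j j<))
    ... | inj₁ (same , _) = vertex-injective w i j (<⇒≤ i<) (<⇒≤ j<) same
    ... | inj₂ (crossed , crossed')
      with vertex-injective w i (suc j) (<⇒≤ i<) j< crossed
         | vertex-injective w (suc i) j i< (<⇒≤ j<) crossed'
    ...   | refl | ()

    closed-by : ∀ {a b vs} → Joins G e a b → SimpleWalk b a vs → Cycle G
    closed-by {a} {b} jab w = record
      { k      = suc L
      ; k≥2    = s≤s (length≥1 w)
      ; vs     = vs
      ; es     = es
      ; step   = step-ok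
      ; closed = trans vs-suc-L (sym (trans (vs-≤ 0 z≤n) (vertex-0 w)))
      ; vs-inj = λ i j i< j< eq → vertex-injective w i j (≤-pred i<) (≤-pred j<)
                   (trans (sym (vs-≤ i (≤-pred i<))) (trans eq (vs-≤ j (≤-pred j<))))
      ; es-inj = es-inj
      }
      where
      L = length w

      vs : ℕ → Fin n
      vs i with i ≤? L
      ... | yes _ = vertex w i
      ... | no  _ = a

      es : ℕ → Fin m
      es i with i <? L
      ... | yes _ = edge w i
      ... | no  _ = e

      vs-≤ : ∀ i → i ≤ L → vs i ≡ vertex w i
      vs-≤ i i≤ with i ≤? L
      ... | yes _  = refl
      ... | no  i≰ = ⊥-elim (i≰ i≤)

      vs-suc-L : vs (suc L) ≡ a
      vs-suc-L with suc L ≤? L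
      ... | yes L<L = ⊥-elim (<-irrefl refl L<L)
      ... | no  _   = refl

      es-< : ∀ i → i < L → es i ≡ edge w i
      es-< i i< with i <? L
      ... | yes _  = refl
      ... | no  i≮ = ⊥-elim (i≮ i<)

      es-≮ : ∀ i → ¬ i < L → es i ≡ e
      es-≮ i i≮ with i <? L
      ... | yes i< = ⊥-elim (i≮ i<)
      ... | no  _  = refl

      last : ∀ i → i < suc L → ¬ i < L → i ≡ L
      last i (s≤s i≤) i≮ with i Data.Nat.≟ L
      ... | yes i≡L = i≡L
      ... | no  i≢L = ⊥-elim (i≮ (≤∧≢⇒< i≤ i≢L))

      length≥1 : ∀ {vs'} (w' : SimpleWalk b a vs') → 1 ≤ length w'
      length≥1 stop         = ⊥-elim (joins⇒≢ jab refl)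
      length≥1 (step _ _ _) = s≤s z≤n

      step-ok : ∀ i → i < suc L → Joins G (es i) (vs i) (vs (suc i))
      step-ok i i<1+L = by-cases (i <? L)
        where
        by-cases : Dec (i < L) → Joins G (es i) (vs i) (vs (suc i))
        by-cases (yes i<) rewrite es-< i i< | vs-≤ i (<⇒≤ i<) | vs-≤ (suc i) i< = edge-joins w i i<
        by-cases (no  i≮) with last i i<1+L i≮
        ... | refl rewrite es-≮ L i≮ | vs-≤ L ≤-refl | vertex-length w | vs-suc-L = joins-sym jab

      es-inj : ∀ i j → i < suc L → j < suc L → es i ≡ es j → i ≡ j
      es-inj i j i<1+L j<1+L eq = by-cases (i <? L) (j <? L)
        where
        by-cases : Dec (i < L) → Dec (j < L) → i ≡ j
        by-cases (yes i<) (yes j<) =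
          edge-injective w i j i< j< (trans (sym (es-< i i<)) (trans eq (es-< j j<)))
        by-cases (yes i<) (no  j≮) =
          ⊥-elim (edge-≢ w i i< (trans (sym (es-< i i<)) (trans eq (es-≮ j j≮))))
        by-cases (no  i≮) (yes j<) =
          ⊥-elim (edge-≢ w j j< (trans (sym (es-< j j<)) (trans (sym eq) (es-≮ i i≮))))
        by-cases (no  i≮) (no  j≮) = trans (last i i<1+L i≮) (sym (last j j<1+L j≮))

  acyclic⇒bridge : Acyclic G → ∀ {e a b} → Joins G e a b → ¬ Star (AdjWithout e) a b
  acyclic⇒bridge acyclic {e} jab walk =
    acyclic (SimpleWalks.closed-by e jab (proj₂ (SimpleWalks.walk⇒simpleWalk e walk)))

module MergedNet {G : Graph} (C : PCMG≤ G) where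
  open Graph G
  open PCMG≤ C
  open GraphFacts G using (Endpoint)

  Place Trans : Set
  Place = MPlace C
  Trans = MTrans C

  -- A place of the merged net carries proofs of p ≢ pa e and p ≢ pb e,
  -- which need not be unique; places are therefore compared through the
  -- slot they occupy.
  Slot : Set
  Slot = Fin n ⊎ Σ (Fin m) (λ e → Fin (np e))

  slot : Place → Slot
  slot (inj₁ v)           = inj₁ v
  slot (inj₂ (e , x , _)) = inj₂ (e , x)

  _≈_ : Place → Place → Set
  r ≈ r' = slot r ≡ slot r'

  _≈?_ : ∀ r r' → Dec (r ≈ r')
  r ≈? r' = Sum.≡-dec _≟ᶠ_ (Product.≡-dec _≟ᶠ_ _≟ᶠ_) (slot r) (slot r')

  -- Merges e r x: place x of component e was merged into place r.
  Merges : (e : Fin m) → Place → Fin (np e) → Set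
  Merges e (inj₁ v)            x = (src e ≡ v × x ≡ pa e) ⊎ (tgt e ≡ v × x ≡ pb e)
  Merges e (inj₂ (e' , y , _)) x = _≡_ {A = Σ (Fin m) (λ e → Fin (np e))} (e' , y) (e , x)

  InComp : Fin m → Place → Set
  InComp e r = ∃[ x ] Merges e r x

  merges-unique : ∀ {e r x y} → Merges e r x → Merges e r y → x ≡ y
  merges-unique {r = inj₁ v} (inj₁ (_ , a)) (inj₁ (_ , b)) = trans a (sym b)
  merges-unique {e} {inj₁ v} (inj₁ (s , _)) (inj₂ (t , _)) = ⊥-elim (loopless e (trans s (sym t)))
  merges-unique {e} {inj₁ v} (inj₂ (t , _)) (inj₁ (s , _)) = ⊥-elim (loopless e (trans s (sym t)))
  merges-unique {r = inj₁ v} (inj₂ (_ , a)) (inj₂ (_ , b)) = trans a (sym b)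
  merges-unique {r = inj₂ _} refl refl = refl

  merges-≈ : ∀ {e r r' x} → Merges e r x → Merges e r' x → r ≈ r'
  merges-≈ {r = inj₁ _} {inj₁ _} (inj₁ (a , _)) (inj₁ (b , _)) = cong inj₁ (trans (sym a) b)
  merges-≈ {e} {inj₁ _} {inj₁ _} (inj₁ (_ , a)) (inj₂ (_ , b)) = ⊥-elim (pa≢pb e (trans (sym a) b))
  merges-≈ {e} {inj₁ _} {inj₁ _} (inj₂ (_ , a)) (inj₁ (_ , b)) = ⊥-elim (pa≢pb e (trans (sym b) a))
  merges-≈ {r = inj₁ _} {inj₁ _} (inj₂ (a , _)) (inj₂ (b , _)) = cong inj₁ (trans (sym a) b)
  merges-≈ {r = inj₁ _} {inj₂ (_ , _ , x≢pa , _)} (inj₁ (_ , a)) refl = ⊥-elim (x≢pa a)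
  merges-≈ {r = inj₁ _} {inj₂ (_ , _ , _ , x≢pb)} (inj₂ (_ , b)) refl = ⊥-elim (x≢pb b)
  merges-≈ {r = inj₂ (_ , _ , x≢pa , _)} {inj₁ _} refl (inj₁ (_ , a)) = ⊥-elim (x≢pa a)
  merges-≈ {r = inj₂ (_ , _ , _ , x≢pb)} {inj₁ _} refl (inj₂ (_ , b)) = ⊥-elim (x≢pb b)
  merges-≈ {r = inj₂ _} {inj₂ _} refl refl = refl

  merges-resp-≈ : ∀ {e r r' x} → r ≈ r' → Merges e r x → Merges e r' x
  merges-resp-≈ {r = inj₁ _} {inj₁ _} refl m = m
  merges-resp-≈ {r = inj₂ _} {inj₂ _} refl m = m

  inComp? : ∀ e r → Dec (InComp e r)
  inComp? e (inj₁ v) with src e ≟ᶠ v | tgt e ≟ᶠ v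
  ... | yes a | _     = yes (pa e , inj₁ (a , refl))
  ... | no _  | yes b = yes (pb e , inj₂ (b , refl))
  ... | no ¬a | no ¬b = no λ { (_ , inj₁ (a , _)) → ¬a a ; (_ , inj₂ (b , _)) → ¬b b }
  inComp? e (inj₂ (e' , y , _)) with e' ≟ᶠ e
  ... | yes refl = yes (y , refl)
  ... | no e'≢e  = no λ { (_ , refl) → e'≢e refl }

  merged : (e : Fin m) → Fin (np e) → Place
  merged e x with x ≟ᶠ pa e | x ≟ᶠ pb e
  ... | yes _   | _       = inj₁ (src e)
  ... | no _    | yes _   = inj₁ (tgt e)
  ... | no x≢pa | no x≢pb = inj₂ (e , x , x≢pa , x≢pb)

  merges-merged : ∀ e x → Merges e (merged e x) x
  merges-merged e x with x ≟ᶠ pa e | x ≟ᶠ pb e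
  ... | yes a | _     = inj₁ (refl , a)
  ... | no _  | yes b = inj₂ (refl , b)
  ... | no _  | no _  = refl

  merges⇒≈merged : ∀ {e r x} → Merges e r x → r ≈ merged e x
  merges⇒≈merged {e} {x = x} m = merges-≈ m (merges-merged e x)

  vertexMerges⇒endpoint : ∀ {e v x} → Merges e (inj₁ v) x → Endpoint e v
  vertexMerges⇒endpoint (inj₁ (a , _)) = inj₁ a
  vertexMerges⇒endpoint (inj₂ (b , _)) = inj₂ b

  shared⇒vertex : ∀ {e e' r x x'} → Merges e r x → Merges e' r x' → e ≢ e' →
                  ∃[ v ] (r ≡ inj₁ v × Endpoint e v × Endpoint e' v)
  shared⇒vertex {r = inj₁ v} m m' _ = v , refl , vertexMerges⇒endpoint m , vertexMerges⇒endpoint m'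
  shared⇒vertex {r = inj₂ _} refl refl e≢e = ⊥-elim (e≢e refl)

  vertexPlace : (e : Fin m) → Fin n → Fin (np e)
  vertexPlace e v with src e ≟ᶠ v
  ... | yes _ = pa e
  ... | no _  = pb e

  vertexPlace-merges : ∀ {e v} → Endpoint e v → Merges e (inj₁ v) (vertexPlace e v)
  vertexPlace-merges {e} {v} ev with src e ≟ᶠ v | ev
  ... | yes a | _      = inj₁ (a , refl)
  ... | no ¬a | inj₁ a = ⊥-elim (¬a a)
  ... | no _  | inj₂ b = inj₂ (b , refl)

  merges⇒vertexPlace : ∀ {e v x} → Merges e (inj₁ v) x → x ≡ vertexPlace e v
  merges⇒vertexPlace m = merges-unique m (vertexPlace-merges (vertexMerges⇒endpoint m))

  canonical : Place → Place
  canonical (inj₁ v)           = inj₁ v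
  canonical (inj₂ (e , x , _)) = merged e x

  canonical-≈ : ∀ r → canonical r ≈ r
  canonical-≈ (inj₁ v)             = refl
  canonical-≈ r@(inj₂ (e , x , _)) = sym (merges⇒≈merged {r = r} refl)

  canonical-cong : ∀ {r r'} → r ≈ r' → canonical r ≡ canonical r'
  canonical-cong {inj₁ _} {inj₁ _} refl = refl
  canonical-cong {inj₂ _} {inj₂ _} refl = refl

  Weighting : Set
  Weighting = (e : Fin m) → Fin (np e) → Fin (nt e) → ℕ

  componentNet : Weighting → Weighting → Fin m → Net
  componentNet w w' e = mkNet (Fin (np e)) (Fin (nt e)) (w e) (w' e)

  -- The formula of mpre and mpost, for arbitrary component weights w.
  module Weights (w : Weighting) where
    weight : Place → Trans → ℕ
    weight (inj₁ v) (e , t) = mweight C src e v (w e (pa e) t) + mweight C tgt e v (w e (pb e) t)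
    weight (inj₂ (e' , y , _)) (e , t) with e' ≟ᶠ e
    ... | yes refl = w e' y t
    ... | no _     = 0

    mweight-end : ∀ (end : Fin m → Fin n) e v k → end e ≡ v → mweight C end e v k ≡ k
    mweight-end end e v k eq with v ≟ᶠ end e
    ... | yes _  = refl
    ... | no ¬eq = ⊥-elim (¬eq (sym eq))

    mweight-¬end : ∀ (end : Fin m → Fin n) e v k → end e ≢ v → mweight C end e v k ≡ 0
    mweight-¬end end e v k ¬eq with v ≟ᶠ end e
    ... | yes eq = ⊥-elim (¬eq (sym eq))
    ... | no _   = refl

    weight-merges : ∀ {e r x} t → Merges e r x → weight r (e , t) ≡ w e x t
    weight-merges {e} {inj₁ v} t (inj₁ (a , refl))
      rewrite mweight-end src e v (w e (pa e) t) a
            | mweight-¬end tgt e v (w e (pb e) t) (λ b → loopless e (trans a (sym b))) = +-identityʳ _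
    weight-merges {e} {inj₁ v} t (inj₂ (b , refl))
      rewrite mweight-¬end src e v (w e (pa e) t) (λ a → loopless e (trans a (sym b)))
            | mweight-end tgt e v (w e (pb e) t) b = refl
    weight-merges {e} {inj₂ _} t refl with e ≟ᶠ e
    ... | yes refl = refl
    ... | no e≢e   = ⊥-elim (e≢e refl)

    weight-outside : ∀ {e r} t → ¬ InComp e r → weight r (e , t) ≡ 0
    weight-outside {e} {inj₁ v} t ∉e
      rewrite mweight-¬end src e v (w e (pa e) t) (λ a → ∉e (pa e , inj₁ (a , refl)))
            | mweight-¬end tgt e v (w e (pb e) t) (λ b → ∉e (pb e , inj₂ (b , refl))) = refl
    weight-outside {e} {inj₂ (e' , y , _)} t ∉e with e' ≟ᶠ e
    ... | yes refl = ⊥-elim (∉e (y , refl))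
    ... | no _     = refl

    weight-pos⇒merges : ∀ {e r} t → 1 ≤ weight r (e , t) → ∃[ x ] (Merges e r x × 1 ≤ w e x t)
    weight-pos⇒merges {e} {r} t pos with inComp? e r
    ... | yes (x , m) = x , m , subst (1 ≤_) (weight-merges t m) pos
    ... | no ∉e with subst (1 ≤_) (weight-outside t ∉e) pos
    ...   | ()

first-step : ∀ {A : Set} {R : Rel A 0ℓ} {a b c} → Star R a b → R b c → ∃[ d ] R a d
first-step ε        r = _ , r
first-step (r ◅ _) _ = _ , r

module BackwardDeterministic {A : Set} (R : Rel A 0ℓ)
  (predecessor-unique : ∀ {b b' c} → R b c → R b' c → b ≡ b') where

  data Path : ℕ → A → A → Set where
    []   : ∀ {a} → Path 0 a a
    _∷ʳ_ : ∀ {k a b c} → Path k a b → R b c → Path (suc k) a c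

  _∷ˡ_ : ∀ {k a b c} → R a b → Path k b c → Path (suc k) a c
  r ∷ˡ []       = [] ∷ʳ r
  r ∷ˡ (p ∷ʳ s) = (r ∷ˡ p) ∷ʳ s

  _++ₚ_ : ∀ {k l a b c} → Path k a b → Path l b c → Path (l + k) a c
  p ++ₚ []       = p
  p ++ₚ (q ∷ʳ r) = (p ++ₚ q) ∷ʳ r

  star⇒path : ∀ {a b} → Star R a b → ∃[ k ] Path k a b
  star⇒path ε        = 0 , []
  star⇒path (r ◅ rs) = suc _ , r ∷ˡ proj₂ (star⇒path rs)

  source-unique : ∀ {k a a' c} → Path k a c → Path k a' c → a ≡ a'
  source-unique []       []         = refl
  source-unique (p ∷ʳ r) (p' ∷ʳ r') with predecessor-unique r r'
  ... | refl = source-unique p p'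

  redirect : ∀ {k a b c c'} → Path (suc k) a c → R b c → R b c' → Path (suc k) a c'
  redirect (p ∷ʳ r) r' r'' with predecessor-unique r r'
  ... | refl = p ∷ʳ r''

  -- Redirecting the last step of c →⁺ c' to c yields, together with c' →⁺ c,
  -- two paths into c of equal length, one from c and one from c'.
  siblings-on-cycle : ∀ {b c c'} → R b c → R b c' → Star R c c' → Star R c' c → c ≡ c'
  siblings-on-cycle {c = c} r r' c→c' c'→c with star⇒path c→c' | star⇒path c'→c
  ... | zero  , [] | _          = refl
  ... | suc _ , _  | zero  , [] = refl
  ... | suc k , p  | suc l , q  =
    source-unique (subst (λ j → Path j c c) (+-comm (suc l) (suc k)) (p ++ₚ q))
                  (q ++ₚ redirect p r' r)

module NetFacts (N : Net) where
  open Net N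

  _ᵒᵖ : Net
  _ᵒᵖ = mkNet Pl Tr post pre

  Step : Pred Pl 0ℓ → Rel Pl 0ℓ
  Step D r s = D r × D s × ∃[ t ] (1 ≤ pre r t × 1 ≤ post s t)

  minimalSiphon-connected : ∀ {D} → MinimalSiphon N D → ∀ {p q} → D p → D q → Star (Step D) p q
  minimalSiphon-connected {D} ((_ , siphon) , minimal) {p} {q} Dp Dq =
    proj₂ (minimal reachesQ proj₁ reachesQ-siphon Dp)
    where
    reachesQ : Pred Pl 0ℓ
    reachesQ s = D s × Star (Step D) s q

    reachesQ-siphon : Siphon N reachesQ
    reachesQ-siphon = (q , Dq , ε) , closed
      where
      closed : ∀ t → ∃[ s ] (reachesQ s × 1 ≤ post s t) → ∃[ r ] (reachesQ r × 1 ≤ pre r t)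
      closed t (s , (Ds , s→q) , out) with siphon t (s , Ds , out)
      ... | r , Dr , in' = r , (Dr , (Dr , Ds , t , in' , out) ◅ s→q) , in'

  ᵒᵖ-markedGraph : MarkedGraph N → MarkedGraph _ᵒᵖ
  ᵒᵖ-markedGraph (unit , inputs , outputs) = (λ p t → ×-swap (unit p t)) , outputs , inputs

  ᵒᵖ-stronglyConnected : StronglyConnected N → StronglyConnected _ᵒᵖ
  ᵒᵖ-stronglyConnected strong x y = reverse arc-reverse (strong y x)
    where
    arc-reverse : ∀ {x y} → Arc N x y → Arc _ᵒᵖ y x
    arc-reverse {inj₁ _} {inj₂ _} a = a
    arc-reverse {inj₂ _} {inj₁ _} a = a

  module _ {D : Pred Pl 0ℓ} (siphon : Siphon N D)
    (output-exists : ∀ {p t} → D p → 1 ≤ pre p t → ∃[ q ] (D q × 1 ≤ post q t))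
    where

    subnetTr⇒input : ∀ {t} → PSubTr N D t → ∃[ p ] (D p × 1 ≤ pre p t)
    subnetTr⇒input {t} (inj₁ out) = proj₂ siphon t out
    subnetTr⇒input     (inj₂ in') = in'

    subnetTr⇒output : ∀ {t} → PSubTr N D t → ∃[ q ] (D q × 1 ≤ post q t)
    subnetTr⇒output (inj₁ out)          = out
    subnetTr⇒output (inj₂ (_ , Dp , i)) = output-exists Dp i

    steps⇒arcs : ∀ {p q} → Star (Step D) p q → Star (PSubArc N D) (inj₁ p) (inj₁ q)
    steps⇒arcs ε = ε
    steps⇒arcs ((Dp , Dq , t , i , o) ◅ rest) =
      _◅_ {j = inj₂ t} (Dp , inj₁ (_ , Dq , o) , i) ((inj₁ (_ , Dq , o) , Dq , o) ◅ steps⇒arcs rest)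

    node⇒place : ∀ x → PSubNode N D x → ∃[ p ] (D p × Star (PSubArc N D) x (inj₁ p))
    node⇒place (inj₁ p) Dp = p , Dp , ε
    node⇒place (inj₂ t) tD with subnetTr⇒output tD
    ... | q , Dq , o = q , Dq , (tD , Dq , o) ◅ ε

    place⇒node : ∀ y → PSubNode N D y → ∃[ p ] (D p × Star (PSubArc N D) (inj₁ p) y)
    place⇒node (inj₁ p) Dp = p , Dp , ε
    place⇒node (inj₂ t) tD with subnetTr⇒input tD
    ... | p , Dp , i = p , Dp , (Dp , tD , i) ◅ ε

    stateMachine-criterion :
      UnitWeighted N →
      (∀ {p q t} → D p → D q → 1 ≤ pre p t → 1 ≤ pre q t → p ≡ q) →
      (∀ {p q t} → D p → D q → 1 ≤ post p t → 1 ≤ post q t → p ≡ q) →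
      (∀ {p q} → D p → D q → Star (Step D) p q) →
      PSubConnectedStateMachine N D
    stateMachine-criterion unit input-unique output-unique connected = stateMachine , strong
      where
      stateMachine : PSubStateMachine N D
      stateMachine t tD with subnetTr⇒input tD | subnetTr⇒output tD
      ... | p , Dp , i | q , Dq , o =
        (λ r _ → unit r t) ,
        (p , Dp , i , λ r Dr i' → input-unique Dr Dp i' i) ,
        (q , Dq , o , λ r Dr o' → output-unique Dr Dq o' o)

      strong : PSubStronglyConnected N D
      strong x y xD yD with node⇒place x xD | place⇒node y yD
      ... | p , Dp , x→p | q , Dq , q→y = x→p ◅◅ steps⇒arcs (connected Dp Dq) ◅◅ q→y

  ᵒᵖ-connectedStateMachine : ∀ {Q} → PSubConnectedStateMachine _ᵒᵖ Q → PSubConnectedStateMachine N Q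
  ᵒᵖ-connectedStateMachine {Q} (stateMachine , strong) = stateMachine' , strong'
    where
    stateMachine' : PSubStateMachine N Q
    stateMachine' t tQ with stateMachine t (⊎-swap tQ)
    ... | unit , input , output = (λ p Qp → ×-swap (unit p Qp)) , output , input

    node : ∀ x → PSubNode N Q x → PSubNode _ᵒᵖ Q x
    node (inj₁ _) Qp = Qp
    node (inj₂ _) tQ = ⊎-swap tQ

    arc-reverse : ∀ {x y} → PSubArc _ᵒᵖ Q x y → PSubArc N Q y x
    arc-reverse {inj₁ _} {inj₂ _} (Qp , tQ , a) = ⊎-swap tQ , Qp , a
    arc-reverse {inj₂ _} {inj₁ _} (tQ , Qp , a) = Qp , ⊎-swap tQ , a

    strong' : PSubStronglyConnected N Q
    strong' x y xQ yQ = reverse arc-reverse (strong y x (node y yQ) (node x xQ))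

module MarkedGraphCircuits (M : Net) (_≟ₜ_ : DecidableEquality (Net.Tr M))
  (marked : MarkedGraph M) (strong : StronglyConnected M) where
  open Net M
  open import Function.Endo.Propositional Pl using (_^_; ^-homo)

  ^-suc-inner : ∀ f k x → (f ^ k) (f x) ≡ (f ^ suc k) x
  ^-suc-inner f zero    x = refl
  ^-suc-inner f (suc k) x = cong f (^-suc-inner f k x)

  inTrans outTrans : Pl → Tr
  inTrans  p = proj₁ (proj₁ (proj₂ marked) p)
  outTrans p = proj₁ (proj₂ (proj₂ marked) p)

  inTrans-output : ∀ p → 1 ≤ post p (inTrans p)
  inTrans-output p = proj₁ (proj₂ (proj₁ (proj₂ marked) p))

  inTrans-unique : ∀ {p t} → 1 ≤ post p t → t ≡ inTrans p
  inTrans-unique {p} = proj₂ (proj₂ (proj₁ (proj₂ marked) p)) _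

  outTrans-input : ∀ p → 1 ≤ pre p (outTrans p)
  outTrans-input p = proj₁ (proj₂ (proj₂ (proj₂ marked) p))

  outTrans-unique : ∀ {p t} → 1 ≤ pre p t → t ≡ outTrans p
  outTrans-unique {p} = proj₂ (proj₂ (proj₂ (proj₂ marked) p)) _

  -- A circuit through x₀, read backwards: every transition chooses one of
  -- its input places, and x₀ is periodic for back = choice ∘ inTrans.
  record Circuit (x₀ : Pl) : Set where
    field
      choice       : Tr → Pl
      choice-input : ∀ t → 1 ≤ pre (choice t) t
      returns      : ∃[ k ] ((λ z → choice (inTrans z)) ^ k) (choice (inTrans x₀)) ≡ x₀

  data PathTo (x₀ : Pl) : Pl → Set where
    done : PathTo x₀ x₀
    step : ∀ {y y'} t → 1 ≤ pre y t → 1 ≤ post y' t → PathTo x₀ y' → PathTo x₀ y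

  arcs⇒pathTo : ∀ {x₀ y} → Star (Arc M) (inj₁ y) (inj₁ x₀) → PathTo x₀ y
  arcs⇒pathTo ε = done
  arcs⇒pathTo (_◅_ {j = inj₂ t} i (_◅_ {j = inj₁ _} o rest)) = step t i o (arcs⇒pathTo rest)

  arcs⇒output : ∀ {x₀ t} → Star (Arc M) (inj₂ t) (inj₁ x₀) → ∃[ y ] (1 ≤ post y t × PathTo x₀ y)
  arcs⇒output (_◅_ {j = inj₁ _} o rest) = _ , o , arcs⇒pathTo rest

  arcs⇒input : ∀ {x t} → Star (Arc M) (inj₁ x) (inj₂ t) → ∃[ y ] (1 ≤ pre y t)
  arcs⇒input (_◅_ {j = inj₂ _} i ε) = _ , i
  arcs⇒input (_◅_ {j = inj₂ _} _ (_◅_ {j = inj₁ _} _ rest)) = arcs⇒input rest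

  pairs : ∀ {x₀ y} → PathTo x₀ y → List (Pl × Tr)
  pairs done                      = []
  pairs {y = y} (step t _ _ rest) = (y , t) ∷ pairs rest

  pairs-input : ∀ {x₀ y} (π : PathTo x₀ y) {z t} → (z , t) ∈ pairs π → 1 ≤ pre z t
  pairs-input (step _ i _ _)    (here refl) = i
  pairs-input (step _ _ _ rest) (there z∈)  = pairs-input rest z∈

  firstInput : (Tr → Pl) → List (Pl × Tr) → Tr → Pl
  firstInput fallback [] t = fallback t
  firstInput fallback ((y , t') ∷ ps) t with t ≟ₜ t'
  ... | yes _ = y
  ... | no  _ = firstInput fallback ps t

  firstInput-input : ∀ {fallback} → (∀ t → 1 ≤ pre (fallback t) t) →
                     ∀ ps → (∀ {z t} → (z , t) ∈ ps → 1 ≤ pre z t) →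
                     ∀ t → 1 ≤ pre (firstInput fallback ps t) t
  firstInput-input fallback-input [] _ t = fallback-input t
  firstInput-input fallback-input ((y , t') ∷ ps) ps-input t with t ≟ₜ t'
  ... | yes refl = ps-input (here refl)
  ... | no  _    = firstInput-input fallback-input ps (λ z∈ → ps-input (there z∈)) t

  firstInput-prefix : ∀ {fallback} ps qs {y t} → (y , t) ∈ ps →
                      ∃[ y' ] ((y' , t) ∈ ps × firstInput fallback (ps ++ qs) t ≡ y')
  firstInput-prefix ((y₁ , t₁) ∷ ps) qs {t = t} y∈ with t ≟ₜ t₁
  ... | yes refl = y₁ , here refl , refl
  firstInput-prefix ((y₁ , t₁) ∷ ps) qs (here refl) | no t≢t = ⊥-elim (t≢t refl)
  firstInput-prefix ((y₁ , t₁) ∷ ps) qs (there y∈) | no _ with firstInput-prefix ps qs y∈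
  ... | y' , y'∈ , eq = y' , there y'∈ , eq

  -- Follow a closed path x₀ → t₀ → ⋯ → x₀, letting every transition choose
  -- the input place through which the path first enters it.
  circuit : ∀ x₀ → Circuit x₀
  circuit x₀ = record
    { choice       = choice
    ; choice-input = firstInput-input fallback-input (pairs loop) (pairs-input loop)
    ; returns      = go ((x₀ , t₀) ∷ []) (λ { (here refl) → 0 , refl }) rest₀ refl back-y₁
    }
    where
    t₀ : Tr
    t₀ = outTrans x₀

    closing : ∃[ y ] (1 ≤ post y t₀ × PathTo x₀ y)
    closing = arcs⇒output (strong (inj₂ t₀) (inj₁ x₀))

    y₁ : Pl
    y₁ = proj₁ closing

    rest₀ : PathTo x₀ y₁
    rest₀ = proj₂ (proj₂ closing)

    loop : PathTo x₀ x₀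
    loop = step t₀ (outTrans-input x₀) (proj₁ (proj₂ closing)) rest₀

    fallback : Tr → Pl
    fallback t = proj₁ (arcs⇒input (strong (inj₁ x₀) (inj₂ t)))

    fallback-input : ∀ t → 1 ≤ pre (fallback t) t
    fallback-input t = proj₂ (arcs⇒input (strong (inj₁ x₀) (inj₂ t)))

    choice : Tr → Pl
    choice = firstInput fallback (pairs loop)

    back : Pl → Pl
    back z = choice (inTrans z)

    Reaches : Pl → Set
    Reaches z = ∃[ k ] ((back ^ k) z ≡ x₀)

    back-y₁ : Reaches (back y₁)
    back-y₁ rewrite sym (inTrans-unique (proj₁ (proj₂ closing))) with t₀ ≟ₜ t₀
    ... | yes _   = 0 , refl
    ... | no t≢t = ⊥-elim (t≢t refl)

    go : ∀ {y} prefix → (∀ {z t} → (z , t) ∈ prefix → Reaches z) → (rest : PathTo x₀ y) →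
         prefix ++ pairs rest ≡ pairs loop → Reaches (back y) → Reaches (back x₀)
    go prefix _ done _ reaches = reaches
    go {y} prefix prefix-reaches (step {y' = y'} t _ o rest) eq (k , back^k[back-y]) =
      go prefix' prefix'-reaches rest eq' back-y'
      where
      prefix' = prefix ++ ((y , t) ∷ [])

      eq' : prefix' ++ pairs rest ≡ pairs loop
      eq' = trans (++-assoc prefix ((y , t) ∷ []) (pairs rest)) eq

      prefix'-reaches : ∀ {z t} → (z , t) ∈ prefix' → Reaches z
      prefix'-reaches z∈ with ∈-++⁻ prefix z∈
      ... | inj₁ z∈prefix  = prefix-reaches z∈prefix
      ... | inj₂ (here refl) = suc k , trans (sym (^-suc-inner back k y)) back^k[back-y]

      back-y' : Reaches (back y')
      back-y' with firstInput-prefix {fallback} prefix' (pairs rest) (∈-++⁺ʳ prefix (here refl))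
      ... | y'' , y''∈ , chosen = subst Reaches (sym back-y'≡) (prefix'-reaches y''∈)
        where
        back-y'≡ : back y' ≡ y''
        back-y'≡ = trans (cong choice (sym (inTrans-unique o)))
                     (trans (cong (λ ps → firstInput fallback ps t) (sym eq')) chosen)

  module OnCircuit {x₀ : Pl} (c : Circuit x₀) where
    open Circuit c

    back : Pl → Pl
    back z = choice (inTrans z)

    OnCircuit : Pl → Set
    OnCircuit z = ∃[ j ] ((back ^ j) x₀ ≡ z)

    start-on : OnCircuit x₀
    start-on = 0 , refl

    back-on : ∀ {z} → OnCircuit z → OnCircuit (back z)
    back-on (j , refl) = suc j , refl

    back-input : ∀ z → 1 ≤ pre (back z) (inTrans z)
    back-input z = choice-input (inTrans z)

    ^-+ : ∀ m n x → (back ^ (m + n)) x ≡ (back ^ m) ((back ^ n) x)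
    ^-+ m n x = cong (λ f → f x) (^-homo back m n)

    period : ℕ
    period = suc (proj₁ returns)

    periodic : ∀ i → (back ^ (i * period)) x₀ ≡ x₀
    periodic zero    = refl
    periodic (suc i) = begin
      (back ^ (period + i * period)) x₀   ≡⟨ ^-+ period (i * period) x₀ ⟩
      (back ^ period) ((back ^ (i * period)) x₀) ≡⟨ cong (back ^ period) (periodic i) ⟩
      (back ^ period) x₀                  ≡⟨ sym (^-suc-inner back (proj₁ returns) x₀) ⟩
      (back ^ proj₁ returns) (back x₀)    ≡⟨ proj₂ returns ⟩
      x₀                                  ∎
      where open ≡-Reasoning

    on⇒reaches-start : ∀ {a} → OnCircuit a → ∃[ n ] ((back ^ n) a ≡ x₀)
    on⇒reaches-start (i , refl) = i * proj₁ returns , (begin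
      (back ^ (i * proj₁ returns)) ((back ^ i) x₀)  ≡⟨ sym (^-+ (i * proj₁ returns) i x₀) ⟩
      (back ^ (i * proj₁ returns + i)) x₀           ≡⟨ cong (λ k → (back ^ k) x₀) i*K+i≡i*period ⟩
      (back ^ (i * period)) x₀                      ≡⟨ periodic i ⟩
      x₀                                            ∎)
      where
      open ≡-Reasoning
      i*K+i≡i*period : i * proj₁ returns + i ≡ i * period
      i*K+i≡i*period = trans (+-comm (i * proj₁ returns) i) (sym (*-suc i (proj₁ returns)))

    on-circuit-connected : ∀ {a b} → OnCircuit a → OnCircuit b → ∃[ n ] ((back ^ n) a ≡ b)
    on-circuit-connected {a} a-on (j , refl) with on⇒reaches-start a-on
    ... | n , a→x₀ = j + n , trans (^-+ j n a) (cong (back ^ j) a→x₀)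

    circuit-induction : (P : Pl → Set) → (∀ {z} → OnCircuit z → P z → P (back z)) →
                        ∀ {a b} → OnCircuit a → OnCircuit b → P a → P b
    circuit-induction P preserved {a} a-on b-on Pa with on-circuit-connected a-on b-on
    ... | n , refl = proj₂ (iterate n)
      where
      iterate : ∀ n → OnCircuit ((back ^ n) a) × P ((back ^ n) a)
      iterate zero    = a-on , Pa
      iterate (suc n) with iterate n
      ... | on , P-on = back-on on , preserved on P-on

    on⇒back-image : ∀ {y} → OnCircuit y → ∃[ z ] (back z ≡ y)
    on⇒back-image (suc j , refl) = (back ^ j) x₀ , refl
    on⇒back-image (zero , refl) with on⇒reaches-start (back-on start-on)
    ... | zero  , back-x₀≡x₀ = x₀ , back-x₀≡x₀
    ... | suc n , eq        = (back ^ n) (back x₀) , eq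

    -- The output transition of a place of the circuit is the one choosing it.
    on-circuit-unique : ∀ {y y' t} → OnCircuit y → OnCircuit y' → 1 ≤ pre y t → 1 ≤ pre y' t → y ≡ y'
    on-circuit-unique {t = t} y-on y'-on i i' = trans (chosen y-on i) (sym (chosen y'-on i'))
      where
      chosen : ∀ {y} → OnCircuit y → 1 ≤ pre y t → y ≡ choice t
      chosen y-on i with on⇒back-image y-on
      ... | z , refl with trans (outTrans-unique i) (sym (outTrans-unique (back-input z)))
      ...   | refl = refl

-- Parametrised by the orientation of the arcs: the reversed orientation
-- turns the traps of the merged net into siphons.
module MergedSiphons {G : Graph} (acyclic : Acyclic G) (C : PCMG≤ G)
  (cpre cpost : MergedNet.Weighting C)
  (component-marked : ∀ e → MarkedGraph (MergedNet.componentNet C cpre cpost e)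
                          × StronglyConnected (MergedNet.componentNet C cpre cpost e))
  (pre post : MPlace C → MTrans C → ℕ)
  (pre-merged  : ∀ r τ → pre r τ ≡ MergedNet.Weights.weight C cpre r τ)
  (post-merged : ∀ r τ → post r τ ≡ MergedNet.Weights.weight C cpost r τ)
  where
  open Graph G
  open PCMG≤ C using (np; nt)
  open GraphFacts G
  open MergedNet C
  module Pre  = Weights cpre
  module Post = Weights cpost

  N : Net
  N = mkNet Place Trans pre post

  open NetFacts N using (Step; minimalSiphon-connected; stateMachine-criterion)

  Input Output : Place → Trans → Set
  Input  r τ = 1 ≤ pre r τ
  Output r τ = 1 ≤ post r τ

  input⇒merges : ∀ {r e t} → Input r (e , t) → ∃[ x ] (Merges e r x × 1 ≤ cpre e x t)
  input⇒merges {r} {e} {t} i = Pre.weight-pos⇒merges t (subst (1 ≤_) (pre-merged r (e , t)) i)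

  output⇒merges : ∀ {r e t} → Output r (e , t) → ∃[ x ] (Merges e r x × 1 ≤ cpost e x t)
  output⇒merges {r} {e} {t} o = Post.weight-pos⇒merges t (subst (1 ≤_) (post-merged r (e , t)) o)

  merges⇒input : ∀ {r e x} t → Merges e r x → 1 ≤ cpre e x t → Input r (e , t)
  merges⇒input {r} {e} t m i =
    subst (1 ≤_) (sym (trans (pre-merged r (e , t)) (Pre.weight-merges t m))) i

  merges⇒output : ∀ {r e x} t → Merges e r x → 1 ≤ cpost e x t → Output r (e , t)
  merges⇒output {r} {e} t m o =
    subst (1 ≤_) (sym (trans (post-merged r (e , t)) (Post.weight-merges t m))) o

  input⇒inComp : ∀ {r e t} → Input r (e , t) → InComp e r
  input⇒inComp i = _ , proj₁ (proj₂ (input⇒merges i))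

  output⇒inComp : ∀ {r e t} → Output r (e , t) → InComp e r
  output⇒inComp o = _ , proj₁ (proj₂ (output⇒merges o))

  input-resp-≈ : ∀ {r r'} τ → r ≈ r' → Input r τ → Input r' τ
  input-resp-≈ (e , t) r≈r' i with input⇒merges i
  ... | x , m , i' = merges⇒input t (merges-resp-≈ r≈r' m) i'

  unitWeighted : UnitWeighted N
  unitWeighted r (e , t) with inComp? e r
  ... | yes (x , m) =
    subst (_≤ 1) (sym (trans (pre-merged r (e , t)) (Pre.weight-merges t m))) (proj₁ (unit x t)) ,
    subst (_≤ 1) (sym (trans (post-merged r (e , t)) (Post.weight-merges t m))) (proj₂ (unit x t))
    where unit = proj₁ (proj₁ (component-marked e))
  ... | no ∉e =
    subst (_≤ 1) (sym (trans (pre-merged r (e , t)) (Pre.weight-outside t ∉e))) z≤n ,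
    subst (_≤ 1) (sym (trans (post-merged r (e , t)) (Post.weight-outside t ∉e))) z≤n

  open module Circuits (e : Fin m) = MarkedGraphCircuits (componentNet cpre cpost e) _≟ᶠ_
    (proj₁ (component-marked e)) (proj₂ (component-marked e))
    using (inTrans; inTrans-output; inTrans-unique; outTrans-unique; circuit)

  input-functional : ∀ {r e t t'} → Input r (e , t) → Input r (e , t') → t ≡ t'
  input-functional i i' with input⇒merges i | input⇒merges i'
  ... | x , m , c | x' , m' , c' with merges-unique m m'
  ...   | refl = trans (outTrans-unique _ c) (sym (outTrans-unique _ c'))

  output-functional : ∀ {r e t t'} → Output r (e , t) → Output r (e , t') → t ≡ t'
  output-functional o o' with output⇒merges o | output⇒merges o'
  ... | x , m , c | x' , m' , c' with merges-unique m m'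
  ...   | refl = trans (inTrans-unique _ c) (sym (inTrans-unique _ c'))

  reentry-at-exit : ∀ {e e' u r} → Endpoint e u → e' ≢ e → Star (AdjWithout e) u (src e') →
                    InComp e r → InComp e' r → r ≡ inj₁ u
  reentry-at-exit {u = u} eu e'≢e u→e' (_ , m) (_ , m')
    with shared⇒vertex m m' (≢-sym e'≢e)
  ... | z , refl , ez , e'z with z ≟ᶠ u
  ...   | yes refl = refl
  ...   | no z≢u = ⊥-elim (acyclic⇒bridge acyclic (endpoints⇒joins eu ez (≢-sym z≢u))
                             (u→e' ◅◅ endpoints-connected e'≢e (inj₁ refl) e'z))

  walk-via-shared : ∀ {e e₁ e₂ u r} → e₁ ≢ e → e₂ ≢ e → InComp e₁ r → InComp e₂ r →
                    Star (AdjWithout e) u (src e₁) → Star (AdjWithout e) u (src e₂)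
  walk-via-shared {e₁ = e₁} {e₂} e₁≢e e₂≢e (_ , m₁) (_ , m₂) u→e₁ with e₁ ≟ᶠ e₂
  ... | yes refl = u→e₁
  ... | no e₁≢e₂ with shared⇒vertex m₁ m₂ e₁≢e₂
  ...   | z , refl , e₁z , e₂z =
    u→e₁ ◅◅ endpoints-connected e₁≢e (inj₁ refl) e₁z ◅◅ endpoints-connected e₂≢e e₂z (inj₁ refl)

  module OfMinimalSiphon (D : Pred Place 0ℓ) (minimal : MinimalSiphon N D) where
    siphon : ∀ τ → ∃[ s ] (D s × Output s τ) → ∃[ q ] (D q × Input q τ)
    siphon = proj₂ (proj₁ minimal)

    ≈⇒≡ : ∀ {r r'} → D r → D r' → r ≈ r' → r ≡ r'
    ≈⇒≡ {r} {r'} Dr Dr' r≈r' = sym (proj₂ (proj₂ minimal D' proj₁ D'-siphon Dr') (sym r≈r'))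
      where
      D' : Pred Place 0ℓ
      D' s = D s × (s ≈ r → s ≡ r)

      D'-siphon : Siphon N D'
      D'-siphon = (r , Dr , λ _ → refl) , closed
        where
        closed : ∀ τ → ∃[ s ] (D' s × Output s τ) → ∃[ q ] (D' q × Input q τ)
        closed τ (s , (Ds , _) , o) with siphon τ (s , Ds , o)
        ... | q , Dq , i with q ≈? r
        ...   | yes q≈r = r , (Dr , λ _ → refl) , input-resp-≈ τ q≈r i
        ...   | no q≉r  = q , (Dq , λ q≈r → ⊥-elim (q≉r q≈r)) , i

    connected : ∀ {p q} → D p → D q → Star (Step D) p q
    connected = minimalSiphon-connected minimal

    StepIn : Fin m → Rel Place 0ℓ
    StepIn e r s = D r × D s × ∃[ t ] (Input r (e , t) × Output s (e , t))

    -- A path of the subnet from x either is still in component e, or has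
    -- left it at a vertex u along a walk of G avoiding e.
    data Excursion (e : Fin m) (x s : Place) : Set where
      inside  : InComp e s → Star (StepIn e) x s → Excursion e x s
      outside : ¬ InComp e s → (u : Fin n) → Endpoint e u → Star (StepIn e) x (inj₁ u) →
                (e' : Fin m) → e' ≢ e → InComp e' s → Star (AdjWithout e) u (src e') →
                Excursion e x s

    exit : ∀ {e e' x s} → Excursion e x s → e' ≢ e → InComp e' s →
           ∃[ u ] (Endpoint e u × Star (StepIn e) x (inj₁ u) × Star (AdjWithout e) u (src e'))
    exit (inside (_ , m) π) e'≢e (_ , m') with shared⇒vertex m m' (≢-sym e'≢e)
    ... | u , refl , eu , e'u = u , eu , π , endpoints-connected e'≢e e'u (inj₁ refl)
    exit (outside _ u eu π _ e₁≢e s∈e₁ u→e₁) e'≢e s∈e' =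
      u , eu , π , walk-via-shared e₁≢e e'≢e s∈e₁ s∈e' u→e₁

    step-inside : ∀ {e x s s' t} → Excursion e x s → D s → D s' →
                  Input s (e , t) → Output s' (e , t) → Excursion e x s'
    step-inside (inside _ π) Ds Ds' i o = inside (output⇒inComp o) (π ◅◅ (Ds , Ds' , _ , i , o) ◅ ε)
    step-inside (outside ∉e _ _ _ _ _ _ _) _ _ i _ = ⊥-elim (∉e (input⇒inComp i))

    step-outside : ∀ {e e' x s s' t} → Excursion e x s → e' ≢ e →
                   Input s (e' , t) → Output s' (e' , t) → Excursion e x s'
    step-outside {e} {s' = s'} exc e'≢e i o with exit exc e'≢e (input⇒inComp i) | inComp? e s'
    ... | u , eu , π , u→e' | yes s'∈e with reentry-at-exit eu e'≢e u→e' s'∈e (output⇒inComp o)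
    ...   | refl = inside s'∈e π
    step-outside exc e'≢e i o | u , eu , π , u→e' | no s'∉e =
      outside s'∉e u eu π _ e'≢e (output⇒inComp o) u→e'

    follow : ∀ {e x s y} → Excursion e x s → Star (Step D) s y → InComp e y → Star (StepIn e) x y
    follow (inside _ π)                 ε _   = π
    follow (outside ∉e _ _ _ _ _ _ _) ε y∈e = ⊥-elim (∉e y∈e)
    follow {e} exc ((Ds , Ds' , (e' , t) , i , o) ◅ rest) y∈e with e' ≟ᶠ e
    ... | yes refl = follow (step-inside exc Ds Ds' i o) rest y∈e
    ... | no e'≢e  = follow (step-outside exc e'≢e i o) rest y∈e

    stays-in-component : ∀ {e x y} → InComp e x → InComp e y → Star (Step D) x y → Star (StepIn e) x y
    stays-in-component x∈e y∈e x→y = follow (inside x∈e ε) x→y y∈e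

    StepAvoiding : Place → Rel Place 0ℓ
    StepAvoiding z a b = Step D a b × a ≢ z × b ≢ z

    no-return-avoiding : ∀ {e e' w r q} → Endpoint e w → e' ≢ e → InComp e' r → r ≢ inj₁ w →
                         Star (AdjWithout e) w (src e') → Star (StepAvoiding (inj₁ w)) r q →
                         ¬ InComp e q
    no-return-avoiding ew e'≢e r∈e' r≢w w→e' ε q∈e = r≢w (reentry-at-exit ew e'≢e w→e' q∈e r∈e')
    no-return-avoiding {e} ew e'≢e r∈e' r≢w w→e' (((_ , _ , (e₁ , _) , i , o) , _ , s≢w) ◅ rest) q∈e
      with e₁ ≟ᶠ e
    ... | yes refl = r≢w (reentry-at-exit ew e'≢e w→e' (input⇒inComp i) r∈e')
    ... | no e₁≢e  = no-return-avoiding ew e₁≢e (output⇒inComp o) s≢w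
                       (walk-via-shared e'≢e e₁≢e r∈e' (input⇒inComp i) w→e') rest q∈e

    input-unique : ∀ {q₁ q₂ τ} → D q₁ → D q₂ → Input q₁ τ → Input q₂ τ → q₁ ≡ q₂
    input-unique {q₁} {q₂} {e , t} Dq₁ Dq₂ i₁ i₂ with q₁ ≈? q₂
    ... | yes q₁≈q₂ = ≈⇒≡ Dq₁ Dq₂ q₁≈q₂
    ... | no q₁≉q₂ = ⊥-elim (proj₁ (proj₂ (proj₂ minimal D' proj₁ D'-siphon Dq₂)) refl)
      where
      D' : Pred Place 0ℓ
      D' s = D s × s ≢ q₂ × Star (StepAvoiding q₂) s q₁

      D'q₁ : D' q₁
      D'q₁ = Dq₁ , (λ q₁≡q₂ → q₁≉q₂ (cong slot q₁≡q₂)) , ε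

      D'-siphon : Siphon N D'
      D'-siphon = (q₁ , D'q₁) , closed
        where
        closed : ∀ τ → ∃[ r ] (D' r × Output r τ) → ∃[ q ] (D' q × Input q τ)
        closed (e' , t') (r , (Dr , r≢q₂ , r→q₁) , o) with siphon (e' , t') (r , Dr , o)
        ... | s , Ds , i with s ≈? q₂
        ...   | no s≉q₂ = s , (Ds , s≢q₂ , ((Ds , Dr , _ , i , o) , s≢q₂ , r≢q₂) ◅ r→q₁) , i
          where s≢q₂ = λ s≡q₂ → s≉q₂ (cong slot s≡q₂)
        ...   | yes s≈q₂ with ≈⇒≡ Ds Dq₂ s≈q₂
        ...     | refl with e' ≟ᶠ e
        ...       | yes refl with input-functional i₂ i
        ...         | refl = q₁ , D'q₁ , i₁
        closed (e' , t') (r , (Dr , r≢q₂ , r→q₁) , o) | s , Ds , i | yes _ | refl | no e'≢e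
          with shared⇒vertex (proj₂ (input⇒inComp i₂)) (proj₂ (input⇒inComp i)) (≢-sym e'≢e)
        ... | w , refl , ew , e'w =
          ⊥-elim (no-return-avoiding ew e'≢e (output⇒inComp o) r≢q₂
                    (endpoints-connected e'≢e e'w (inj₁ refl)) r→q₁ (input⇒inComp i₁))

    output-exists : ∀ {q τ} → D q → Input q τ → ∃[ r ] (D r × Output r τ)
    output-exists {q} {e , t} Dq i with input⇒merges i
    ... | y , m , _ = leave-by-t (siphon (e , t₀) (q , Dq , q-output))
      where
      t₀ : Fin (nt e)
      t₀ = inTrans e y

      q-output : Output q (e , t₀)
      q-output = merges⇒output t₀ m (inTrans-output e y)

      -- q lies on a cycle q → ⋯ → q' → t₀ → q inside component e, and the
      -- step of that cycle leaving q can only use t.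
      leave-by-t : ∃[ q' ] (D q' × Input q' (e , t₀)) → ∃[ r ] (D r × Output r (e , t))
      leave-by-t (q' , Dq' , i')
        with first-step (stays-in-component (_ , m) (input⇒inComp i') (connected Dq Dq'))
                        (Dq' , Dq , t₀ , i' , q-output)
      ... | r , _ , Dr , _ , iq , or with input-functional i iq
      ...   | refl = r , Dr , or

    stepIn-predecessor-unique : ∀ {e b b' c} → StepIn e b c → StepIn e b' c → b ≡ b'
    stepIn-predecessor-unique (Db , _ , _ , ib , oc) (Db' , _ , _ , ib' , oc')
      with output-functional oc oc'
    ... | refl = input-unique Db Db' ib ib'

    output-unique : ∀ {x₁ x₂ τ} → D x₁ → D x₂ → Output x₁ τ → Output x₂ τ → x₁ ≡ x₂
    output-unique {τ = e , t} Dx₁ Dx₂ o₁ o₂ with siphon (e , t) (_ , Dx₁ , o₁)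
    ... | q , Dq , i =
      BackwardDeterministic.siblings-on-cycle (StepIn e) stepIn-predecessor-unique
        (Dq , Dx₁ , t , i , o₁) (Dq , Dx₂ , t , i , o₂)
        (stays-in-component (output⇒inComp o₁) (output⇒inComp o₂) (connected Dx₁ Dx₂))
        (stays-in-component (output⇒inComp o₂) (output⇒inComp o₁) (connected Dx₂ Dx₁))

    connectedStateMachine : PSubConnectedStateMachine N D
    connectedStateMachine =
      stateMachine-criterion (proj₁ minimal) output-exists unitWeighted input-unique output-unique connected

  module Selected (e : Fin m) (x' : Fin (np e)) = Circuits.OnCircuit e (circuit e x')

  -- The selected circuits: the circuit of component e₀ through x₀, and,
  -- whenever a selected circuit passes a vertex place, the circuit through
  -- that place in every other component at that vertex.
  module SiphonThrough (e₀ : Fin m) (x₀ : Fin (np e₀)) where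
    data Activated : Fin m → Fin n → Set where
      from-root : ∀ {w e} → Endpoint e₀ w → Selected.OnCircuit e₀ x₀ (vertexPlace e₀ w) →
                  Endpoint e w → e ≢ e₀ → Activated e w
      from-edge : ∀ {e v w e'} → Activated e v → Endpoint e w → w ≢ v →
                  Selected.OnCircuit e (vertexPlace e v) (vertexPlace e w) →
                  Endpoint e' w → e' ≢ e → Activated e' w

    no-two-entries : ∀ {e v w} → Star (AdjWithout e) (src e₀) v → Star (AdjWithout e) (src e₀) w →
                     Endpoint e v → Endpoint e w → v ≢ w → ⊥
    no-two-entries →v →w ev ew v≢w =
      acyclic⇒bridge acyclic (endpoints⇒joins ev ew v≢w) (walk-reverse →v ◅◅ →w)

    activated-entry : ∀ {e v} → Activated e v → e ≢ e₀ × Endpoint e v × Star (AdjWithout e) (src e₀) v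
    activated-entry (from-root e₀w _ ew e≢e₀) =
      e≢e₀ , ew , endpoints-connected (≢-sym e≢e₀) (inj₁ refl) e₀w
    activated-entry (from-edge {e} {v} {w} {e'} act ew w≢v _ e'w e'≢e) with activated-entry act
    ... | e≢e₀ , ev , →v = e'≢e₀ , e'w , →w
      where
      joins-vw : Joins G e v w
      joins-vw = endpoints⇒joins ev ew (≢-sym w≢v)

      e'≢e₀ : e' ≢ e₀
      e'≢e₀ refl = no-two-entries →v (endpoints-connected (≢-sym e≢e₀) (inj₁ refl) e'w)
                     ev ew (≢-sym w≢v)

      →w : Star (AdjWithout e') (src e₀) w
      →w with avoid-or-reach e'≢e e'w →v
      ... | inj₁ →v' = →v' ◅◅ (e , (≢-sym e'≢e) , joins-vw) ◅ ε
      ... | inj₂ →w' = ⊥-elim (no-two-entries →v →w' ev ew (≢-sym w≢v))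

    activated-unique : ∀ {e v v'} → Activated e v → Activated e v' → v ≡ v'
    activated-unique {v = v} {v'} act act' with v ≟ᶠ v'
    ... | yes v≡v' = v≡v'
    ... | no  v≢v' with activated-entry act | activated-entry act'
    ...   | _ , ev , →v | _ , ev' , →v' = ⊥-elim (no-two-entries →v →v' ev ev' v≢v')

    start-on : ∀ {e x} → Selected.OnCircuit e x x
    start-on = Selected.start-on _ _

    data Start : (e : Fin m) → Fin (np e) → Set where
      root      : Start e₀ x₀
      activated : ∀ {e v} → Activated e v → Start e (vertexPlace e v)

    start-unique : ∀ {e a b} → Start e a → Start e b → a ≡ b
    start-unique root           root            = refl
    start-unique root           (activated act) = ⊥-elim (proj₁ (activated-entry act) refl)
    start-unique (activated act) root           = ⊥-elim (proj₁ (activated-entry act) refl)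
    start-unique (activated act) (activated act') with activated-unique act act'
    ... | refl = refl

    OnSelected : (e : Fin m) → Fin (np e) → Set
    OnSelected e x = ∃[ x' ] (Start e x' × Selected.OnCircuit e x' x)

    onSelected⇒on : ∀ {e x' y} → OnSelected e y → Start e x' → Selected.OnCircuit e x' y
    onSelected⇒on (_ , start , on) start' with start-unique start start'
    ... | refl = on

    onSelected-vertex : ∀ {e e' u} → OnSelected e (vertexPlace e u) → Endpoint e u → Endpoint e' u →
                        e ≢ e' → OnSelected e' (vertexPlace e' u)
    onSelected-vertex (_ , root , on) eu e'u e≢e' =
      _ , activated (from-root eu on e'u (≢-sym e≢e')) , start-on
    onSelected-vertex {e} {e'} {u} (_ , activated {v = v} act , on) eu e'u e≢e' with u ≟ᶠ v
    ... | no u≢v = _ , activated (from-edge act eu u≢v on e'u (≢-sym e≢e')) , start-on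
    ... | yes refl = entered-at act
      where
      entered-at : Activated e u → OnSelected e' (vertexPlace e' u)
      entered-at (from-root e₀u on₀ _ _) with e' ≟ᶠ e₀
      ... | yes refl = _ , root , on₀
      ... | no e'≢e₀ = _ , activated (from-root e₀u on₀ e'u e'≢e₀) , start-on
      entered-at (from-edge {e₁} act₁ e₁u u≢v₁ on₁ _ _) with e' ≟ᶠ e₁
      ... | yes refl = _ , activated act₁ , on₁
      ... | no e'≢e₁ = _ , activated (from-edge act₁ e₁u u≢v₁ on₁ e'u e'≢e₁) , start-on

    Covered : Place → Set
    Covered r = ∃[ e ] ∃[ x ] (Merges e r x × OnSelected e x)

    covered⇒onSelected : ∀ {r e' x'} → Covered r → Merges e' r x' → OnSelected e' x'
    covered⇒onSelected {e' = e'} (e , x , m , sel) m' with e ≟ᶠ e'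
    ... | yes refl with merges-unique m m'
    ...   | refl = sel
    covered⇒onSelected {e' = e'} (e , x , m , sel) m' | no e≢e' with shared⇒vertex m m' e≢e'
    ... | u , refl , eu , e'u with merges⇒vertexPlace m | merges⇒vertexPlace m'
    ...   | refl | refl = onSelected-vertex sel eu e'u e≢e'

    module Containing (p : Place) (p-merges : Merges e₀ p x₀) where
      -- One place per slot, p being the one chosen for its own slot.
      representative : Place → Place
      representative r with r ≈? p
      ... | yes _ = p
      ... | no  _ = canonical r

      representative-≈ : ∀ r → representative r ≈ r
      representative-≈ r with r ≈? p
      ... | yes r≈p = sym r≈p
      ... | no  _   = canonical-≈ r

      representative-cong : ∀ {r r'} → r ≈ r' → representative r ≡ representative r'
      representative-cong {r} {r'} r≈r' with r ≈? p | r' ≈? p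
      ... | yes _   | yes _    = refl
      ... | yes r≈p | no  r'≉p = ⊥-elim (r'≉p (trans (sym r≈r') r≈p))
      ... | no  r≉p | yes r'≈p = ⊥-elim (r≉p (trans r≈r' r'≈p))
      ... | no  _   | no  _    = canonical-cong r≈r'

      representative-p : representative p ≡ p
      representative-p with p ≈? p
      ... | yes _   = refl
      ... | no  p≉p = ⊥-elim (p≉p refl)

      place : (e : Fin m) → Fin (np e) → Place
      place e x = representative (merged e x)

      place-merges : ∀ e x → Merges e (place e x) x
      place-merges e x = merges-resp-≈ (sym (representative-≈ (merged e x))) (merges-merged e x)

      place-representative : ∀ e x → place e x ≡ representative (place e x)
      place-representative e x = sym (representative-cong (representative-≈ (merged e x)))

      vertex-place : ∀ {e e' v} → Endpoint e v → Endpoint e' v →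
                     place e (vertexPlace e v) ≡ place e' (vertexPlace e' v)
      vertex-place ev e'v = representative-cong
        (trans (sym (merges⇒≈merged (vertexPlace-merges ev))) (merges⇒≈merged (vertexPlace-merges e'v)))

      M : Pred Place 0ℓ
      M r = Covered r × r ≡ representative r

      M⇒place : ∀ {r e x} → M r → Merges e r x → r ≡ place e x
      M⇒place (_ , r≡rep) m = trans r≡rep (representative-cong (merges⇒≈merged m))

      p∈M : M p
      p∈M = (e₀ , x₀ , p-merges , x₀ , root , start-on) , sym representative-p

      M-siphon : Siphon N M
      M-siphon = (p , p∈M) , closed
        where
        closed : ∀ τ → ∃[ r ] (M r × Output r τ) → ∃[ q ] (M q × Input q τ)
        closed (e , t) (r , (cov , _) , o) with output⇒merges o
        ... | x , m , o' with covered⇒onSelected cov m | inTrans-unique e o'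
        ...   | x' , start , on | refl =
          place e (Selected.back e x' x) ,
          ((e , _ , place-merges e _ , x' , start , Selected.back-on e x' on) ,
           place-representative e (Selected.back e x' x)) ,
          merges⇒input (inTrans e x) (place-merges e _) (Selected.back-input e x' x)

      module _ (D' : Pred Place 0ℓ) (D'⊆M : D' ⊆ M) (D'-siphon : Siphon N D') where
        back-closed : ∀ {e x' x} → Start e x' → Selected.OnCircuit e x' x →
                      D' (place e x) → D' (place e (Selected.back e x' x))
        back-closed {e} {x'} {x} start on Dx
          with proj₂ D'-siphon (e , inTrans e x)
                 (place e x , Dx , merges⇒output (inTrans e x) (place-merges e x) (inTrans-output e x))
        ... | s , Ds , i with input⇒merges i
        ...   | y , m , i'
          with Selected.on-circuit-unique e x'
                 (onSelected⇒on (covered⇒onSelected (proj₁ (D'⊆M Ds)) m) start)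
                 (Selected.back-on e x' on) i' (Selected.back-input e x' x)
        ...     | refl = subst D' (M⇒place (D'⊆M Ds) m) Ds

        along : ∀ {e x' a b} → Start e x' → Selected.OnCircuit e x' a → Selected.OnCircuit e x' b →
                D' (place e a) → D' (place e b)
        along {e} {x'} start = Selected.circuit-induction e x' (λ z → D' (place e z)) (back-closed start)

        to-start : ∀ {e x' a} → Start e x' → Selected.OnCircuit e x' a → D' (place e a) → D' (place e x')
        to-start start on = along start on start-on

        from-start : ∀ {e x' a} → Start e x' → Selected.OnCircuit e x' a → D' (place e x') → D' (place e a)
        from-start start on = along start start-on on

        vertex-reaches-root : ∀ {e v} → Activated e v → D' (place e (vertexPlace e v)) → D' (place e₀ x₀)
        vertex-reaches-root (from-root e₀w on₀ ew _) Dv =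
          to-start root on₀ (subst D' (vertex-place ew e₀w) Dv)
        vertex-reaches-root (from-edge act e₁w _ on₁ ew _) Dv =
          vertex-reaches-root act (to-start (activated act) on₁ (subst D' (vertex-place ew e₁w) Dv))

        root-reaches-vertex : ∀ {e v} → Activated e v → D' (place e₀ x₀) → D' (place e (vertexPlace e v))
        root-reaches-vertex (from-root e₀w on₀ ew _) D-root =
          subst D' (vertex-place e₀w ew) (from-start root on₀ D-root)
        root-reaches-vertex (from-edge act e₁w _ on₁ ew _) D-root =
          subst D' (vertex-place e₁w ew) (from-start (activated act) on₁ (root-reaches-vertex act D-root))

        reaches-root : ∀ {e x} → OnSelected e x → D' (place e x) → D' (place e₀ x₀)
        reaches-root (_ , root , on)          Dx = to-start root on Dx
        reaches-root (_ , activated act , on) Dx = vertex-reaches-root act (to-start (activated act) on Dx)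

        root-reaches : ∀ {e x} → OnSelected e x → D' (place e₀ x₀) → D' (place e x)
        root-reaches (_ , root , on)          D-root = from-start root on D-root
        root-reaches (_ , activated act , on) D-root = from-start (activated act) on (root-reaches-vertex act D-root)

        M⊆D' : M ⊆ D'
        M⊆D' Mr' with proj₁ D'-siphon
        ... | r , Dr with D'⊆M Dr | Mr'
        ...   | (_ , _ , m , sel) , _ | (_ , _ , m' , sel') , _ =
          subst D' (sym (M⇒place Mr' m'))
            (root-reaches sel' (reaches-root sel (subst D' (M⇒place (D'⊆M Dr) m) Dr)))

      M-minimal : MinimalSiphon N M
      M-minimal = M-siphon , M⊆D'

  minimalSiphon-through : ∀ p → ∃[ D ] (MinimalSiphon N D × D p)
  minimalSiphon-through p@(inj₂ (e , x , _)) = M , M-minimal , p∈M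
    where open SiphonThrough.Containing e x p refl
  minimalSiphon-through (inj₁ v) with any? (λ e → (src e ≟ᶠ v) ⊎-dec (tgt e ≟ᶠ v))
  ... | yes (e , ev) = M , M-minimal , p∈M
    where open SiphonThrough.Containing e (vertexPlace e v) (inj₁ v) (vertexPlace-merges ev)
  ... | no isolated = (_≡ inj₁ v) , (((inj₁ v , refl) , closed) , minimal) , refl
    where
    closed : ∀ τ → ∃[ r ] (r ≡ inj₁ v × Output r τ) → ∃[ q ] (q ≡ inj₁ v × Input q τ)
    closed τ (_ , refl , o) with output⇒merges o
    ... | _ , m , _ = ⊥-elim (isolated (_ , vertexMerges⇒endpoint m))

    minimal : ∀ D' → D' ⊆ (_≡ inj₁ v) → Siphon N D' → (_≡ inj₁ v) ⊆ D'
    minimal D' D'⊆v ((r , D'r) , _) refl = subst D' (D'⊆v D'r) D'r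

mpre-weight : ∀ {G} (C : PCMG≤ G) r τ → mpre C r τ ≡ MergedNet.Weights.weight C (PCMG≤.cpre C) r τ
mpre-weight C (inj₁ _) _ = refl
mpre-weight C (inj₂ (e , _)) (e' , _) with e ≟ᶠ e'
... | yes refl = refl
... | no  _    = refl

mpost-weight : ∀ {G} (C : PCMG≤ G) r τ → mpost C r τ ≡ MergedNet.Weights.weight C (PCMG≤.cpost C) r τ
mpost-weight C (inj₁ _) _ = refl
mpost-weight C (inj₂ (e , _)) (e' , _) with e ≟ᶠ e'
... | yes refl = refl
... | no  _    = refl

theorem10 : (G : Graph) → Acyclic G → GConnected G →
    (C : PCMG≤ G) → WellStructured C →
      (∀ p → (∃[ D ] (MinimalSiphon (net C) D × D p))
           × (∃[ Q ] (MinimalTrap (net C) Q × Q p)))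
    × (∀ (D : Pred (Net.Pl (net C)) 0ℓ) → MinimalSiphon (net C) D →
         PSubConnectedStateMachine (net C) D)
    × (∀ (Q : Pred (Net.Pl (net C)) 0ℓ) → MinimalTrap (net C) Q →
         PSubConnectedStateMachine (net C) Q)
theorem10 G acyclic _ C well-structured =
  (λ p → Siphons.minimalSiphon-through p , Traps.minimalSiphon-through p) ,
  (λ D minimal → Siphons.OfMinimalSiphon.connectedStateMachine D minimal) ,
  (λ Q minimal → NetFacts.ᵒᵖ-connectedStateMachine (net C)
                   (Traps.OfMinimalSiphon.connectedStateMachine Q minimal))
  where
  open PCMG≤ C using (cpre; cpost)

  marked : ∀ e → MarkedGraph (comp C e) × StronglyConnected (comp C e)
  marked e = proj₁ (well-structured e) , proj₁ (proj₂ (well-structured e))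

  marked-ᵒᵖ : ∀ e → MarkedGraph (NetFacts._ᵒᵖ (comp C e)) × StronglyConnected (NetFacts._ᵒᵖ (comp C e))
  marked-ᵒᵖ e = NetFacts.ᵒᵖ-markedGraph (comp C e) (proj₁ (marked e)) ,
                NetFacts.ᵒᵖ-stronglyConnected (comp C e) (proj₂ (marked e))

  module Siphons = MergedSiphons acyclic C cpre cpost marked
                     (mpre C) (mpost C) (mpre-weight C) (mpost-weight C)
  module Traps   = MergedSiphons acyclic C cpost cpre marked-ᵒᵖ
                     (mpost C) (mpre C) (mpost-weight C) (mpre-weight C)
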